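{- Let $X$ be a finite alphabet with $|X|=N$, symbols of types GEN, PROP, KILL with counts $g,t,k$, $g\ge1$; let $x_1,x_2,\dots$ be i.i.d. uniform on $X$, $\sigma_0=0$, $\sigma_j=T_{x_j}(\sigma_{j-1})$, $\nu_L=\sum_{j=1}^L\sigma_j$, and $D_{\mathrm{trans}}(L)=\mathrm{Var}(\nu_L)/\mathrm E[\nu_L]$. With $\mu=t/N$, $\pi_0=k/(g+k)$ and $D_\infty=\pi_0(1+\mu)/(1-\mu)$ (the limiting dispersion index of the stationary chain), we have \[D_{\mathrm{trans}}(L)=D_\infty+O(1/L)\quad(L\to\infty).\]
   Context: GEN symbols act on the state space $\{0,1\}$ as the constant map $1$, PROP as the identity, KILL as the constant map $0$; $T_x$ is the action of $x$. -}

module Defs where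

open import Data.Nat as ℕ using (ℕ; zero; suc)
open import Data.Bool using (Bool; true; false)
open import Data.Fin using (Fin)
open import Data.Vec using (Vec; []; _∷_)
open import Data.List using (List; []; _∷_; map; concatMap; foldr; filter; length)
open import Data.List.Base using (allFin)
open import Data.Integer using (+_)
open import Data.Rational using (ℚ; 0ℚ; 1ℚ; _+_; _-_; _*_; _÷_; ≢-nonZero)
open import Data.Rational.Properties using (_≟_)
open import Relation.Nullary using (yes; no)
open import Relation.Binary.PropositionalEquality using (_≡_)

data SymType : Set where
  GEN PROP KILL : SymType

T : SymType → Bool → Bool
T GEN  _ = true
T PROP s = s
T KILL _ = false

bit : Bool → ℕ
bit true  = 1
bit false = 0

isType : SymType → SymType → Bool
isType GEN  GEN  = true
isType PROP PROP = true
isType KILL KILL = true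
isType _    _    = false

count : (N : ℕ) → (Fin N → SymType) → SymType → ℕ
count N typ τ = length (Data.List.filter (λ x → Data.Bool._≟_ (isType τ (typ x)) true) (allFin N))

νFrom : {N L : ℕ} → (Fin N → SymType) → Bool → Vec (Fin N) L → ℕ
νFrom typ s []       = 0
νFrom typ s (x ∷ w)  = bit (T (typ x) s) ℕ.+ νFrom typ (T (typ x) s) w

ν : {N L : ℕ} → (Fin N → SymType) → Vec (Fin N) L → ℕ
ν typ w = νFrom typ false w

words : (N L : ℕ) → List (Vec (Fin N) L)
words N zero    = [] ∷ []
words N (suc L) = concatMap (λ x → map (x ∷_) (words N L)) (allFin N)

ℕ→ℚ : ℕ → ℚ
ℕ→ℚ n = (+ n) Data.Rational./ 1

-- Total division on ℚ (p / 0 := 0); only used where denominators are nonzero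
_/'_ : ℚ → ℚ → ℚ
p /' q with q ≟ 0ℚ
... | yes _  = 0ℚ
... | no q≢0 = _÷_ p q {{≢-nonZero q≢0}}

E : (N L : ℕ) → (Vec (Fin N) L → ℚ) → ℚ
E N L f = foldr _+_ 0ℚ (map f (words N L)) /' ℕ→ℚ (N ℕ.^ L)

Eν : (N : ℕ) → (Fin N → SymType) → ℕ → ℚ
Eν N typ L = E N L (λ w → ℕ→ℚ (ν typ w))

Varν : (N : ℕ) → (Fin N → SymType) → ℕ → ℚ
Varν N typ L = E N L (λ w → ℕ→ℚ (ν typ w) * ℕ→ℚ (ν typ w)) - Eν N typ L * Eν N typ L

Dtrans : (N : ℕ) → (Fin N → SymType) → ℕ → ℚ
Dtrans N typ L = Varν N typ L /' Eν N typ L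

Dinf : (N : ℕ) → (Fin N → SymType) → ℚ
Dinf N typ = (π₀ * (1ℚ + μ)) /' (1ℚ - μ)
  where
    g = count N typ GEN
    t = count N typ PROP
    k = count N typ KILL
    μ  = ℕ→ℚ t /' ℕ→ℚ N
    π₀ = ℕ→ℚ k /' ℕ→ℚ (g ℕ.+ k)

-- Appending a letter sends (ν, σ) to (ν + 1, 1) for the g GEN letters, to (ν + σ, σ) for the
-- t PROP letters and to (ν, 0) for the k KILL letters.  Hence the sums over all words of length L
-- of 1, σ_L, ν_L, ν_L σ_L and ν_L² obey a linear recursion in L, with n = g + t + k = N.  A quadratic
-- form Ψ in these five moments is multiplied by n² at every step, so it keeps its initial value
-- g²tn times M² = n^(2L).  Rewritten with H = F M − P A ≤ n M² and g M − κ P = g t^L ≤ g M,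
-- where κ = g + k, this shows κ⁴(B M − A²) − k(n + t) κ² A M = O(M²); dividing by κ⁴ A M gives
-- D_trans − D_∞.  Finally κ A + t P = g L M, so κ A ≥ L M / 2 once L ≥ 2t, and the error is O(1/L).

module Submission where

open import Data.Bool using (Bool; true; false)
open import Data.Fin using (Fin)
open import Data.List using (List; []; _∷_; _++_; map; foldr; concatMap; filter; length; allFin)
open import Data.List.Properties using (map-++; map-cong; map-∘; length-tabulate)
open import Data.Nat using (ℕ; suc)
open import Function using (_∘_)
open import Relation.Binary.PropositionalEquality
open import Defs

module Naturals where

  open import Data.Nat
  open import Data.Nat.ListAction using (sum)
  open import Data.Nat.ListAction.Properties using (sum-++)
  open import Data.Nat.Properties
  open import Data.Nat.Tactic.RingSolver using (solve)

  excess-scales : ∀ {x y x′ y′} s e → x′ + s * y ≡ y′ + s * x → x ≡ y + e → x′ ≡ y′ + s * e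
  excess-scales {y = y} {x′} {y′} s e eq refl = +-cancelʳ-≡ (s * y) x′ (y′ + s * e) (begin
    x′ + s * y         ≡⟨ eq ⟩
    y′ + s * (y + e)   ≡⟨ solve (y′ ∷ s ∷ y ∷ e ∷ []) ⟩
    y′ + s * e + s * y ∎)
    where open ≡-Reasoning

  m+x≡n+y⇒∣m-n∣≤x+y : ∀ {m n x y} → m + x ≡ n + y → ∣ m - n ∣ ≤ x + y
  m+x≡n+y⇒∣m-n∣≤x+y {m} {n} {x} {y} eq = begin
    ∣ m - n ∣         ≡⟨ ∣m+n-m+o∣≡∣n-o∣ x m n ⟨
    ∣ x + m - x + n ∣ ≡⟨ cong₂ ∣_-_∣ (trans (+-comm x m) eq) (+-comm x n) ⟩
    ∣ n + y - n + x ∣ ≡⟨ ∣m+n-m+o∣≡∣n-o∣ n y x ⟩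
    ∣ y - x ∣         ≤⟨ ∣m-n∣≤m⊔n y x ⟩
    y ⊔ x             ≤⟨ m⊔n≤m+n y x ⟩
    y + x             ≡⟨ +-comm y x ⟩
    x + y             ∎
    where open ≤-Reasoning

  ∑ : {A : Set} → List A → (A → ℕ) → ℕ
  ∑ xs f = sum (map f xs)

  ∑-cong : ∀ {A : Set} (xs : List A) {f h : A → ℕ} → (∀ x → f x ≡ h x) → ∑ xs f ≡ ∑ xs h
  ∑-cong xs f≗h = cong sum (map-cong f≗h xs)

  ∑-++ : ∀ {A : Set} (xs ys : List A) f → ∑ (xs ++ ys) f ≡ ∑ xs f + ∑ ys f
  ∑-++ xs ys f = trans (cong sum (map-++ f xs ys)) (sum-++ (map f xs) (map f ys))

  ∑-map : ∀ {A B : Set} (h : A → B) xs (f : B → ℕ) → ∑ (map h xs) f ≡ ∑ xs (f ∘ h)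
  ∑-map h xs f = cong sum (sym (map-∘ xs))

  ∑-concatMap : ∀ {A B : Set} (h : A → List B) xs f → ∑ (concatMap h xs) f ≡ ∑ xs (λ x → ∑ (h x) f)
  ∑-concatMap h []       f = refl
  ∑-concatMap h (x ∷ xs) f =
    trans (∑-++ (h x) (concatMap h xs) f) (cong (∑ (h x) f +_) (∑-concatMap h xs f))

  ∑-const-1 : ∀ {A : Set} (xs : List A) → ∑ xs (λ _ → 1) ≡ length xs
  ∑-const-1 []       = refl
  ∑-const-1 (x ∷ xs) = cong suc (∑-const-1 xs)

module Rationals where

  open import Data.Integer.Base using (+_)
  import Data.Integer as ℤ
  import Data.Integer.Properties as ℤₚ
  open import Data.Nat
  open import Data.Nat.Coprimality using (1-coprimeTo) renaming (sym to coprime-sym)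
  open import Data.Nat.ListAction using (sum)
  open import Data.Nat.Properties
  open import Data.Rational using (ℚ; 0ℚ; 1ℚ; toℚᵘ)
  import Data.Rational as ℚ
  import Data.Rational.Properties as ℚₚ
  open import Data.Rational.Unnormalised using (mkℚᵘ; *≡*)
  import Data.Rational.Unnormalised as ℚᵘ
  import Data.Rational.Unnormalised.Properties as ℚᵘₚ
  open import Data.Sum using ([_,_]′)
  open import Level using (0ℓ)
  open import Relation.Nullary using (yes; no; contradiction)
  open import Relation.Nullary.Decidable using (dec⇒maybe)
  import Tactic.RingSolver as Ring
  open import Tactic.RingSolver.Core.AlmostCommutativeRing using (AlmostCommutativeRing; fromCommutativeRing)

  ℚ-ring : AlmostCommutativeRing 0ℓ 0ℓ
  ℚ-ring = fromCommutativeRing ℚₚ.+-*-commutativeRing (λ x → dec⇒maybe (0ℚ ℚₚ.≟ x))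

  toℚᵘ-ℕ→ℚ : ∀ n → toℚᵘ (ℕ→ℚ n) ≡ mkℚᵘ (+ n) 0
  toℚᵘ-ℕ→ℚ n = cong toℚᵘ (ℚₚ.normalize-coprime (coprime-sym (1-coprimeTo n)))

  ℕ→ℚ-homo-+ : ∀ m n → ℕ→ℚ (m + n) ≡ ℕ→ℚ m ℚ.+ ℕ→ℚ n
  ℕ→ℚ-homo-+ m n = ℚₚ.toℚᵘ-injective (ℚᵘₚ.≃-trans (ℚᵘₚ.≃-reflexive (toℚᵘ-ℕ→ℚ (m + n)))
    (ℚᵘₚ.≃-trans sum≃ (ℚᵘₚ.≃-sym (ℚₚ.toℚᵘ-homo-+ (ℕ→ℚ m) (ℕ→ℚ n)))))
    where
    sum≃ : mkℚᵘ (+ (m + n)) 0 ℚᵘ.≃ toℚᵘ (ℕ→ℚ m) ℚᵘ.+ toℚᵘ (ℕ→ℚ n)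
    sum≃ rewrite toℚᵘ-ℕ→ℚ m | toℚᵘ-ℕ→ℚ n =
      *≡* (cong (ℤ._* + 1) (sym (cong₂ ℤ._+_ (ℤₚ.*-identityʳ (+ m)) (ℤₚ.*-identityʳ (+ n)))))

  ℕ→ℚ-homo-* : ∀ m n → ℕ→ℚ (m * n) ≡ ℕ→ℚ m ℚ.* ℕ→ℚ n
  ℕ→ℚ-homo-* m n = ℚₚ.toℚᵘ-injective (ℚᵘₚ.≃-trans (ℚᵘₚ.≃-reflexive (toℚᵘ-ℕ→ℚ (m * n)))
    (ℚᵘₚ.≃-trans product≃ (ℚᵘₚ.≃-sym (ℚₚ.toℚᵘ-homo-* (ℕ→ℚ m) (ℕ→ℚ n)))))
    where
    product≃ : mkℚᵘ (+ (m * n)) 0 ℚᵘ.≃ toℚᵘ (ℕ→ℚ m) ℚᵘ.* toℚᵘ (ℕ→ℚ n)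
    product≃ rewrite toℚᵘ-ℕ→ℚ m | toℚᵘ-ℕ→ℚ n =
      *≡* (trans (ℤₚ.*-identityʳ _) (trans (ℤₚ.pos-* m n) (sym (ℤₚ.*-identityʳ _))))

  ℕ→ℚ-mono-≤ : ∀ {m n} → m ≤ n → ℕ→ℚ m ℚ.≤ ℕ→ℚ n
  ℕ→ℚ-mono-≤ {m} {n} m≤n = ℚₚ.toℚᵘ-cancel-≤ (subst₂ ℚᵘ._≤_ (sym (toℚᵘ-ℕ→ℚ m)) (sym (toℚᵘ-ℕ→ℚ n))
    (ℚᵘ.*≤* (subst₂ ℤ._≤_ (sym (ℤₚ.*-identityʳ (+ m))) (sym (ℤₚ.*-identityʳ (+ n))) (ℤ.+≤+ m≤n))))

  ℕ→ℚ-nonNeg : ∀ n → 0ℚ ℚ.≤ ℕ→ℚ n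
  ℕ→ℚ-nonNeg n = ℕ→ℚ-mono-≤ {n = n} z≤n

  ℕ→ℚ-sum : ∀ xs → foldr ℚ._+_ 0ℚ (map ℕ→ℚ xs) ≡ ℕ→ℚ (sum xs)
  ℕ→ℚ-sum []       = refl
  ℕ→ℚ-sum (x ∷ xs) = trans (cong (ℕ→ℚ x ℚ.+_) (ℕ→ℚ-sum xs)) (sym (ℕ→ℚ-homo-+ x (sum xs)))

  ℕ→ℚ-∣-∣ : ∀ m n → ℚ.∣ ℕ→ℚ m ℚ.- ℕ→ℚ n ∣ ≡ ℕ→ℚ ∣ m - n ∣
  ℕ→ℚ-∣-∣ m n = [ ordered , swapped ]′ (≤-total m n)
    where
    open ≡-Reasoning
    x-[x+y]≡-y : ∀ x y → x ℚ.- (x ℚ.+ y) ≡ ℚ.- y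
    x-[x+y]≡-y = Ring.solve-∀ ℚ-ring
    x-y≡-[y-x] : ∀ x y → x ℚ.- y ≡ ℚ.- (y ℚ.- x)
    x-y≡-[y-x] = Ring.solve-∀ ℚ-ring
    ordered : ∀ {m n} → m ≤ n → ℚ.∣ ℕ→ℚ m ℚ.- ℕ→ℚ n ∣ ≡ ℕ→ℚ ∣ m - n ∣
    ordered {m} {n} m≤n = begin
      ℚ.∣ ℕ→ℚ m ℚ.- ℕ→ℚ n ∣                   ≡⟨ cong (λ x → ℚ.∣ ℕ→ℚ m ℚ.- ℕ→ℚ x ∣) (m+[n∸m]≡n m≤n) ⟨
      ℚ.∣ ℕ→ℚ m ℚ.- ℕ→ℚ (m + (n ∸ m)) ∣       ≡⟨ cong (λ x → ℚ.∣ ℕ→ℚ m ℚ.- x ∣) (ℕ→ℚ-homo-+ m (n ∸ m)) ⟩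
      ℚ.∣ ℕ→ℚ m ℚ.- (ℕ→ℚ m ℚ.+ ℕ→ℚ (n ∸ m)) ∣ ≡⟨ cong ℚ.∣_∣ (x-[x+y]≡-y (ℕ→ℚ m) (ℕ→ℚ (n ∸ m))) ⟩
      ℚ.∣ ℚ.- ℕ→ℚ (n ∸ m) ∣                    ≡⟨ ℚₚ.∣-p∣≡∣p∣ (ℕ→ℚ (n ∸ m)) ⟩
      ℚ.∣ ℕ→ℚ (n ∸ m) ∣                        ≡⟨ ℚₚ.0≤p⇒∣p∣≡p (ℕ→ℚ-nonNeg (n ∸ m)) ⟩
      ℕ→ℚ (n ∸ m)                              ≡⟨ cong ℕ→ℚ (m≤n⇒∣m-n∣≡n∸m m≤n) ⟨
      ℕ→ℚ ∣ m - n ∣                            ∎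
    swapped : n ≤ m → ℚ.∣ ℕ→ℚ m ℚ.- ℕ→ℚ n ∣ ≡ ℕ→ℚ ∣ m - n ∣
    swapped n≤m = begin
      ℚ.∣ ℕ→ℚ m ℚ.- ℕ→ℚ n ∣           ≡⟨ cong ℚ.∣_∣ (x-y≡-[y-x] (ℕ→ℚ m) (ℕ→ℚ n)) ⟩
      ℚ.∣ ℚ.- (ℕ→ℚ n ℚ.- ℕ→ℚ m) ∣     ≡⟨ ℚₚ.∣-p∣≡∣p∣ (ℕ→ℚ n ℚ.- ℕ→ℚ m) ⟩
      ℚ.∣ ℕ→ℚ n ℚ.- ℕ→ℚ m ∣           ≡⟨ ordered n≤m ⟩
      ℕ→ℚ ∣ n - m ∣                   ≡⟨ cong ℕ→ℚ (∣-∣-comm n m) ⟩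
      ℕ→ℚ ∣ m - n ∣                   ∎

  /'-*-cancel : ∀ p {q} → q ≢ 0ℚ → (p /' q) ℚ.* q ≡ p
  /'-*-cancel p {q} q≢0 with q ℚₚ.≟ 0ℚ
  ... | yes q≡0 = contradiction q≡0 q≢0
  ... | no q≢0′ = begin
    p ℚ.* ℚ.1/ q ℚ.* q   ≡⟨ ℚₚ.*-assoc p (ℚ.1/ q) q ⟩
    p ℚ.* (ℚ.1/ q ℚ.* q) ≡⟨ cong (p ℚ.*_) (ℚₚ.*-inverseˡ q) ⟩
    p ℚ.* 1ℚ            ≡⟨ ℚₚ.*-identityʳ p ⟩
    p                    ∎
    where
    open ≡-Reasoning
    instance _ = ℚ.≢-nonZero q≢0′

  ℕ→ℚ-≢0 : ∀ n .{{_ : NonZero n}} → ℕ→ℚ n ≢ 0ℚ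
  ℕ→ℚ-≢0 n = ℚₚ.<⇒≢ (ℚₚ.positive⁻¹ (ℕ→ℚ n) {{ℚₚ.normalize-pos n 1}}) ∘ sym

  inverse-linear-bound : ∀ {x} {d e s L : ℕ} .{{_ : NonZero s}} .{{_ : NonZero L}} → 0ℚ ℚ.≤ x →
    x ℚ.* ℕ→ℚ d ℚ.≤ ℕ→ℚ (e * s) → L * s ≤ 2 * d → x ℚ.≤ ℕ→ℚ (2 * e) ℚ.* (ℕ→ℚ 1 /' ℕ→ℚ L)
  inverse-linear-bound {x} {d} {e} {s} {L} 0≤x xd≤es Ls≤2d = ℚₚ.*-cancelʳ-≤-pos (ℕ→ℚ L) {{ℚₚ.normalize-pos L 1}} (begin
    x ℚ.* ℕ→ℚ L                                         ≤⟨ xL≤2e ⟩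
    ℕ→ℚ (2 * e)                                         ≡⟨ ℚₚ.*-identityʳ (ℕ→ℚ (2 * e)) ⟨
    ℕ→ℚ (2 * e) ℚ.* 1ℚ                                  ≡⟨ cong (ℕ→ℚ (2 * e) ℚ.*_) (/'-*-cancel 1ℚ (ℕ→ℚ-≢0 L)) ⟨
    ℕ→ℚ (2 * e) ℚ.* ((ℕ→ℚ 1 /' ℕ→ℚ L) ℚ.* ℕ→ℚ L)       ≡⟨ ℚₚ.*-assoc (ℕ→ℚ (2 * e)) (ℕ→ℚ 1 /' ℕ→ℚ L) (ℕ→ℚ L) ⟨
    ℕ→ℚ (2 * e) ℚ.* (ℕ→ℚ 1 /' ℕ→ℚ L) ℚ.* ℕ→ℚ L         ∎)
    where
    open ℚₚ.≤-Reasoning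
    instance _ = ℚ.nonNegative 0≤x
    xL≤2e : x ℚ.* ℕ→ℚ L ℚ.≤ ℕ→ℚ (2 * e)
    xL≤2e = ℚₚ.*-cancelʳ-≤-pos (ℕ→ℚ s) {{ℚₚ.normalize-pos s 1}} (begin
      x ℚ.* ℕ→ℚ L ℚ.* ℕ→ℚ s       ≡⟨ ℚₚ.*-assoc x (ℕ→ℚ L) (ℕ→ℚ s) ⟩
      x ℚ.* (ℕ→ℚ L ℚ.* ℕ→ℚ s)     ≡⟨ cong (x ℚ.*_) (ℕ→ℚ-homo-* L s) ⟨
      x ℚ.* ℕ→ℚ (L * s)           ≤⟨ ℚₚ.*-monoˡ-≤-nonNeg x (ℕ→ℚ-mono-≤ Ls≤2d) ⟩
      x ℚ.* ℕ→ℚ (2 * d)           ≡⟨ cong (x ℚ.*_) (ℕ→ℚ-homo-* 2 d) ⟩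
      x ℚ.* (ℕ→ℚ 2 ℚ.* ℕ→ℚ d)     ≡⟨ x[yz]≡y[xz] x (ℕ→ℚ 2) (ℕ→ℚ d) ⟩
      ℕ→ℚ 2 ℚ.* (x ℚ.* ℕ→ℚ d)     ≤⟨ ℚₚ.*-monoˡ-≤-nonNeg (ℕ→ℚ 2) {{ℚ.nonNegative (ℕ→ℚ-nonNeg 2)}} xd≤es ⟩
      ℕ→ℚ 2 ℚ.* ℕ→ℚ (e * s)       ≡⟨ ℕ→ℚ-homo-* 2 (e * s) ⟨
      ℕ→ℚ (2 * (e * s))           ≡⟨ cong ℕ→ℚ (*-assoc 2 e s) ⟨
      ℕ→ℚ (2 * e * s)             ≡⟨ ℕ→ℚ-homo-* (2 * e) s ⟩
      ℕ→ℚ (2 * e) ℚ.* ℕ→ℚ s       ∎)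
      where
      x[yz]≡y[xz] : ∀ x y z → x ℚ.* (y ℚ.* z) ≡ y ℚ.* (x ℚ.* z)
      x[yz]≡y[xz] = Ring.solve-∀ ℚ-ring

  variance-identity : ∀ {D e s a b m} → D ℚ.* e ≡ s ℚ.- e ℚ.* e → e ℚ.* m ≡ a → s ℚ.* m ≡ b →
    D ℚ.* (a ℚ.* m) ≡ b ℚ.* m ℚ.- a ℚ.* a
  variance-identity {D} {e} {s} {m = m} De≡s-e² refl refl = begin
    D ℚ.* (e ℚ.* m ℚ.* m)                  ≡⟨ Ring.solve (D ∷ e ∷ m ∷ []) ℚ-ring ⟩
    D ℚ.* e ℚ.* (m ℚ.* m)                  ≡⟨ cong (ℚ._* (m ℚ.* m)) De≡s-e² ⟩
    (s ℚ.- e ℚ.* e) ℚ.* (m ℚ.* m)          ≡⟨ Ring.solve (e ∷ s ∷ m ∷ []) ℚ-ring ⟩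
    s ℚ.* m ℚ.* m ℚ.- e ℚ.* m ℚ.* (e ℚ.* m) ∎
    where open ≡-Reasoning

  dispersion-ratio : ∀ a b m → a ≢ 0ℚ → m ≢ 0ℚ →
    ((b /' m ℚ.- (a /' m) ℚ.* (a /' m)) /' (a /' m)) ℚ.* (a ℚ.* m) ≡ b ℚ.* m ℚ.- a ℚ.* a
  dispersion-ratio a b m a≢0 m≢0 =
    variance-identity {D = (b /' m ℚ.- (a /' m) ℚ.* (a /' m)) /' (a /' m)} {a /' m} {b /' m}
      (/'-*-cancel _ mean≢0) (/'-*-cancel a m≢0) (/'-*-cancel b m≢0)
    where
    mean≢0 : a /' m ≢ 0ℚ
    mean≢0 mean≡0 = a≢0 (begin
      a                  ≡⟨ /'-*-cancel a m≢0 ⟨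
      (a /' m) ℚ.* m     ≡⟨ cong (ℚ._* m) mean≡0 ⟩
      0ℚ ℚ.* m           ≡⟨ ℚₚ.*-zeroˡ m ⟩
      0ℚ                 ∎)
      where open ≡-Reasoning

  limit-identity : ∀ {D μ π n κ t k} → D ℚ.* (1ℚ ℚ.- μ) ≡ π ℚ.* (1ℚ ℚ.+ μ) → μ ℚ.* n ≡ t → π ℚ.* κ ≡ k →
    (1ℚ ℚ.- μ) ℚ.* n ≡ κ → D ℚ.* (κ ℚ.* κ) ≡ k ℚ.* (n ℚ.+ t)
  limit-identity {D} {μ} {π} {n} D[1-μ]≡π[1+μ] refl refl refl = begin
    D ℚ.* ((1ℚ ℚ.- μ) ℚ.* n ℚ.* ((1ℚ ℚ.- μ) ℚ.* n))     ≡⟨ Ring.solve (D ∷ μ ∷ n ∷ []) ℚ-ring ⟩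
    D ℚ.* (1ℚ ℚ.- μ) ℚ.* ((1ℚ ℚ.- μ) ℚ.* n ℚ.* n)       ≡⟨ cong (ℚ._* ((1ℚ ℚ.- μ) ℚ.* n ℚ.* n)) D[1-μ]≡π[1+μ] ⟩
    π ℚ.* (1ℚ ℚ.+ μ) ℚ.* ((1ℚ ℚ.- μ) ℚ.* n ℚ.* n)       ≡⟨ Ring.solve (π ∷ μ ∷ n ∷ []) ℚ-ring ⟩
    π ℚ.* ((1ℚ ℚ.- μ) ℚ.* n) ℚ.* (n ℚ.+ μ ℚ.* n)        ∎
    where open ≡-Reasoning

  difference-identity : ∀ {Dt D∞ x y α β γ} → Dt ℚ.* α ≡ β ℚ.- γ → D∞ ℚ.* x ≡ y →
    (Dt ℚ.- D∞) ℚ.* (x ℚ.* (x ℚ.* α)) ≡ x ℚ.* (x ℚ.* β) ℚ.- (x ℚ.* (x ℚ.* γ) ℚ.+ y ℚ.* (x ℚ.* α))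
  difference-identity {Dt} {D∞} {x} {α = α} {β} {γ} Dtα≡β-γ refl = begin
    (Dt ℚ.- D∞) ℚ.* (x ℚ.* (x ℚ.* α))                         ≡⟨ Ring.solve (Dt ∷ D∞ ∷ x ∷ α ∷ []) ℚ-ring ⟩
    x ℚ.* (x ℚ.* (Dt ℚ.* α)) ℚ.- D∞ ℚ.* x ℚ.* (x ℚ.* α)       ≡⟨ cong (λ z → x ℚ.* (x ℚ.* z) ℚ.- D∞ ℚ.* x ℚ.* (x ℚ.* α)) Dtα≡β-γ ⟩
    x ℚ.* (x ℚ.* (β ℚ.- γ)) ℚ.- D∞ ℚ.* x ℚ.* (x ℚ.* α)        ≡⟨ Ring.solve (D∞ ∷ x ∷ α ∷ β ∷ γ ∷ []) ℚ-ring ⟩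
    x ℚ.* (x ℚ.* β) ℚ.- (x ℚ.* (x ℚ.* γ) ℚ.+ D∞ ℚ.* x ℚ.* (x ℚ.* α)) ∎
    where open ≡-Reasoning

  [1-μ]n≡κ : ∀ {μ n κ t} → μ ℚ.* n ≡ t → n ≡ κ ℚ.+ t → (1ℚ ℚ.- μ) ℚ.* n ≡ κ
  [1-μ]n≡κ {μ} {n} {κ} refl n≡κ+μn = begin
    (1ℚ ℚ.- μ) ℚ.* n           ≡⟨ Ring.solve (μ ∷ n ∷ []) ℚ-ring ⟩
    n ℚ.- μ ℚ.* n              ≡⟨ cong (ℚ._- μ ℚ.* n) n≡κ+μn ⟩
    κ ℚ.+ μ ℚ.* n ℚ.- μ ℚ.* n  ≡⟨ Ring.solve (κ ∷ μ ∷ n ∷ []) ℚ-ring ⟩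
    κ                          ∎
    where open ≡-Reasoning

  limit-ratio : ∀ t k κ N .{{_ : NonZero N}} .{{_ : NonZero κ}} → N ≡ κ + t →
    ((ℕ→ℚ k /' ℕ→ℚ κ) ℚ.* (1ℚ ℚ.+ ℕ→ℚ t /' ℕ→ℚ N)) /' (1ℚ ℚ.- ℕ→ℚ t /' ℕ→ℚ N) ℚ.* ℕ→ℚ (κ * κ)
      ≡ ℕ→ℚ (k * (N + t))
  limit-ratio t k κ N N≡κ+t = begin
    D ℚ.* ℕ→ℚ (κ * κ)              ≡⟨ cong (D ℚ.*_) (ℕ→ℚ-homo-* κ κ) ⟩
    D ℚ.* (ℕ→ℚ κ ℚ.* ℕ→ℚ κ)        ≡⟨ limit-identity {D} {μ} {ℕ→ℚ k /' ℕ→ℚ κ} {ℕ→ℚ N} {ℕ→ℚ κ} (/'-*-cancel _ 1-μ≢0) μN≡t (/'-*-cancel (ℕ→ℚ k) (ℕ→ℚ-≢0 κ)) [1-μ]N≡κ ⟩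
    ℕ→ℚ k ℚ.* (ℕ→ℚ N ℚ.+ ℕ→ℚ t)    ≡⟨ cong (ℕ→ℚ k ℚ.*_) (ℕ→ℚ-homo-+ N t) ⟨
    ℕ→ℚ k ℚ.* ℕ→ℚ (N + t)          ≡⟨ ℕ→ℚ-homo-* k (N + t) ⟨
    ℕ→ℚ (k * (N + t))              ∎
    where
    open ≡-Reasoning
    μ D : ℚ
    μ = ℕ→ℚ t /' ℕ→ℚ N
    D = ((ℕ→ℚ k /' ℕ→ℚ κ) ℚ.* (1ℚ ℚ.+ μ)) /' (1ℚ ℚ.- μ)
    μN≡t : μ ℚ.* ℕ→ℚ N ≡ ℕ→ℚ t
    μN≡t = /'-*-cancel (ℕ→ℚ t) (ℕ→ℚ-≢0 N)
    [1-μ]N≡κ : (1ℚ ℚ.- μ) ℚ.* ℕ→ℚ N ≡ ℕ→ℚ κ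
    [1-μ]N≡κ = [1-μ]n≡κ {μ} {ℕ→ℚ N} {ℕ→ℚ κ} μN≡t (trans (cong ℕ→ℚ N≡κ+t) (ℕ→ℚ-homo-+ κ t))
    1-μ≢0 : 1ℚ ℚ.- μ ≢ 0ℚ
    1-μ≢0 1-μ≡0 = ℕ→ℚ-≢0 κ (begin
      ℕ→ℚ κ                  ≡⟨ [1-μ]N≡κ ⟨
      (1ℚ ℚ.- μ) ℚ.* ℕ→ℚ N    ≡⟨ cong (ℚ._* ℕ→ℚ N) 1-μ≡0 ⟩
      0ℚ ℚ.* ℕ→ℚ N            ≡⟨ ℚₚ.*-zeroˡ (ℕ→ℚ N) ⟩
      0ℚ                      ∎)

module Observables where

  open import Data.Nat
  open import Data.Nat.Tactic.RingSolver using (solve)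

  record Quadratic : Set where
    constructor quadratic
    field c₀ c₁ c₂ c₃ c₄ : ℕ

  -- INLINE here and below lets the ring solver see the polynomial behind the name.
  ⟦_⟧ : Quadratic → ℕ → ℕ → ℕ
  ⟦ q ⟧ v σ = c₀ + c₁ * σ + c₂ * v + c₃ * (v * σ) + c₄ * (v * v)
    where open Quadratic q
  {-# INLINE ⟦_⟧ #-}

  ν-observable : ∀ v σ → ⟦ quadratic 0 0 1 0 0 ⟧ v σ ≡ v
  ν-observable v σ = solve (v ∷ σ ∷ [])

  ν²-observable : ∀ v σ → ⟦ quadratic 0 0 0 0 1 ⟧ v σ ≡ v * v
  ν²-observable v σ = solve (v ∷ σ ∷ [])

module Moments (g t k : ℕ) where

  open import Data.Nat
  open import Data.Nat.Properties
  open import Data.Nat.Tactic.RingSolver using (solve)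
  open Naturals using (excess-scales; m+x≡n+y⇒∣m-n∣≤x+y)
  open Observables

  n κ : ℕ
  n = g + t + k
  κ = g + k
  {-# INLINE n #-}
  {-# INLINE κ #-}

  -- Over the words of length L: M counts them, P and Q count those with σ_L = 1 and σ_L = 0,
  -- A, F and B sum ν_L, ν_L σ_L and ν_L², and H = F M − P A (FM≡PA+H).
  M P Q A F B H : ℕ → ℕ
  M L = n ^ L
  P zero    = 0
  P (suc L) = g * M L + t * P L
  Q zero    = 1
  Q (suc L) = k * M L + t * Q L
  A zero    = 0
  A (suc L) = n * A L + P (suc L)
  F zero    = 0
  F (suc L) = g * A L + t * F L + P (suc L)
  B zero    = 0
  B (suc L) = n * B L + 2 * (g * A L + t * F L) + P (suc L)
  H zero    = 0
  H (suc L) = t * n * H L + P (suc L) * Q (suc L)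

  _·_ : Quadratic → ℕ → ℕ
  q · L = c₀ * M L + c₁ * P L + c₂ * A L + c₃ * F L + c₄ * B L
    where open Quadratic q
  {-# INLINE _·_ #-}

  -- The coefficients of g ⟦ q ⟧ (v + 1) 1 + t ⟦ q ⟧ (v + σ) σ + k ⟦ q ⟧ v 0, using σ² = σ.
  step : Quadratic → Quadratic
  step q = quadratic (n * c₀ + g * (c₁ + c₂ + c₃ + c₄)) (t * (c₁ + c₂ + c₃ + c₄))
                     (n * c₂ + g * (c₃ + 2 * c₄)) (t * (c₃ + 2 * c₄)) (n * c₄)
    where open Quadratic q
  {-# INLINE step #-}

  ⟦step⟧ : ∀ q v s →
    g * ⟦ q ⟧ (v + 1) 1 + t * ⟦ q ⟧ (v + bit s) (bit s) + k * ⟦ q ⟧ (v + 0) 0 ≡ ⟦ step q ⟧ v (bit s)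
  ⟦step⟧ (quadratic a b c d e) v false = solve (g ∷ t ∷ k ∷ a ∷ b ∷ c ∷ d ∷ e ∷ v ∷ [])
  ⟦step⟧ (quadratic a b c d e) v true  = solve (g ∷ t ∷ k ∷ a ∷ b ∷ c ∷ d ∷ e ∷ v ∷ [])

  step-· : ∀ q L → step q · L ≡ q · suc L
  step-· (quadratic c₀ c₁ c₂ c₃ c₄) L with M L | P L | A L | F L | B L
  ... | m | p | a | f | b = solve (g ∷ t ∷ k ∷ c₀ ∷ c₁ ∷ c₂ ∷ c₃ ∷ c₄ ∷ m ∷ p ∷ a ∷ f ∷ b ∷ [])

  ⟦⟧-at-0 : ∀ q → ⟦ q ⟧ 0 0 ≡ q · 0
  ⟦⟧-at-0 (quadratic a b c d e) = solve (a ∷ b ∷ c ∷ d ∷ e ∷ [])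

  ν-moment : ∀ L → quadratic 0 0 1 0 0 · L ≡ A L
  ν-moment L with A L
  ... | a = solve (a ∷ [])

  ν²-moment : ∀ L → quadratic 0 0 0 0 1 · L ≡ B L
  ν²-moment L with B L
  ... | b = solve (b ∷ [])

  M≡P+Q : ∀ L → M L ≡ P L + Q L
  M≡P+Q zero = refl
  M≡P+Q (suc L) with M L | P L | Q L | M≡P+Q L
  ... | _ | p | q | refl = solve (g ∷ t ∷ k ∷ p ∷ q ∷ [])

  P≤M : ∀ L → P L ≤ M L
  P≤M L = subst (P L ≤_) (sym (M≡P+Q L)) (m≤m+n (P L) (Q L))

  Q≤M : ∀ L → Q L ≤ M L
  Q≤M L = subst (Q L ≤_) (sym (M≡P+Q L)) (m≤n+m (Q L) (P L))

  κP+gtᴸ≡gM : ∀ L → κ * P L + g * t ^ L ≡ g * M L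
  κP+gtᴸ≡gM zero = solve (g ∷ k ∷ [])
  κP+gtᴸ≡gM (suc L) with M L | P L | t ^ L | κP+gtᴸ≡gM L
  ... | m | p | r | ih = begin
    κ * (g * m + t * p) + g * (t * r) ≡⟨ solve (g ∷ t ∷ k ∷ m ∷ p ∷ r ∷ []) ⟩
    κ * g * m + t * (κ * p + g * r)   ≡⟨ cong (λ x → κ * g * m + t * x) ih ⟩
    κ * g * m + t * (g * m)           ≡⟨ solve (g ∷ t ∷ k ∷ m ∷ []) ⟩
    g * (n * m)                       ∎
    where open ≡-Reasoning

  gtᴸ≤gM : ∀ L → g * t ^ L ≤ g * M L
  gtᴸ≤gM L = subst (g * t ^ L ≤_) (κP+gtᴸ≡gM L) (m≤n+m (g * t ^ L) (κ * P L))

  FM≡PA+H : ∀ L → F L * M L ≡ P L * A L + H L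
  FM≡PA+H zero = refl
  FM≡PA+H (suc L) with M L | P L | Q L | A L | F L | H L | M≡P+Q L | FM≡PA+H L
  ... | _ | p | q | a | f | h | refl | ih = begin
    (g * a + t * f + (g * (p + q) + t * p)) * (n * (p + q))
      ≡⟨ solve (g ∷ t ∷ k ∷ p ∷ q ∷ a ∷ f ∷ []) ⟩
    t * n * (f * (p + q)) + n * (p + q) * (g * a + (g * (p + q) + t * p))
      ≡⟨ cong (λ x → t * n * x + n * (p + q) * (g * a + (g * (p + q) + t * p))) ih ⟩
    t * n * (p * a + h) + n * (p + q) * (g * a + (g * (p + q) + t * p))
      ≡⟨ solve (g ∷ t ∷ k ∷ p ∷ q ∷ a ∷ h ∷ []) ⟩
    (g * (p + q) + t * p) * (n * a + (g * (p + q) + t * p))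
      + (t * n * h + (g * (p + q) + t * p) * (k * (p + q) + t * q)) ∎
    where open ≡-Reasoning

  H≤nM² : 1 ≤ κ → ∀ L → H L ≤ n * (M L * M L)
  H≤nM² 1≤κ zero    = z≤n
  H≤nM² 1≤κ (suc L) = begin
    t * n * H L + P (suc L) * Q (suc L)
      ≤⟨ +-mono-≤ (*-monoʳ-≤ (t * n) (H≤nM² 1≤κ L)) (*-mono-≤ (P≤M (suc L)) (Q≤M (suc L))) ⟩
    t * n * (n * (M L * M L)) + M (suc L) * M (suc L)
      ≡⟨ regroup (M L) ⟩
    suc t * (M (suc L) * M (suc L))
      ≤⟨ *-monoˡ-≤ (M (suc L) * M (suc L)) 1+t≤n ⟩
    n * (M (suc L) * M (suc L)) ∎
    where
    open ≤-Reasoning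
    regroup : ∀ m → t * n * (n * (m * m)) + n * m * (n * m) ≡ suc t * (n * m * (n * m))
    regroup m = solve (g ∷ t ∷ k ∷ m ∷ [])
    1+t≤n : suc t ≤ n
    1+t≤n = begin
      1 + t ≤⟨ +-monoˡ-≤ t 1≤κ ⟩
      κ + t ≡⟨ solve (g ∷ t ∷ k ∷ []) ⟩
      n     ∎

  κA+tP≡gLM : ∀ L → κ * A L + t * P L ≡ g * L * M L
  κA+tP≡gLM zero = solve (g ∷ t ∷ k ∷ [])
  κA+tP≡gLM (suc L) with M L | P L | A L | κA+tP≡gLM L
  ... | m | p | a | ih = begin
    κ * (n * a + (g * m + t * p)) + t * (g * m + t * p) ≡⟨ solve (g ∷ t ∷ k ∷ m ∷ p ∷ a ∷ []) ⟩
    n * (κ * a + t * p) + g * (n * m)                   ≡⟨ cong (λ x → n * x + g * (n * m)) ih ⟩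
    n * (g * L * m) + g * (n * m)                       ≡⟨ solve (g ∷ t ∷ k ∷ L ∷ m ∷ []) ⟩
    g * suc L * (n * m)                                 ∎
    where open ≡-Reasoning

  1≤g⇒1≤κ : 1 ≤ g → 1 ≤ κ
  1≤g⇒1≤κ 1≤g = ≤-trans 1≤g (m≤m+n g k)

  1≤g⇒1≤n : 1 ≤ g → 1 ≤ n
  1≤g⇒1≤n 1≤g = ≤-trans 1≤g (≤-trans (m≤m+n g t) (m≤m+n (g + t) k))

  LM≤2κA : 1 ≤ g → ∀ L → 2 * t ≤ L → L * M L ≤ 2 * (κ * A L)
  LM≤2κA 1≤g L 2t≤L = linear (κA+tP≡gLM L) (P≤M L)
    where
    open ≤-Reasoning
    linear : ∀ {m p a} → κ * a + t * p ≡ g * L * m → p ≤ m → L * m ≤ 2 * (κ * a)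
    linear {m} {p} {a} eq p≤m = +-cancelʳ-≤ (L * m) _ _ (begin
      L * m + L * m           ≡⟨ solve (L ∷ m ∷ []) ⟩
      2 * (1 * L * m)         ≤⟨ *-monoʳ-≤ 2 (*-monoˡ-≤ m (*-monoˡ-≤ L 1≤g)) ⟩
      2 * (g * L * m)         ≡⟨ cong (2 *_) eq ⟨
      2 * (κ * a + t * p)     ≤⟨ *-monoʳ-≤ 2 (+-monoʳ-≤ (κ * a) (*-monoʳ-≤ t p≤m)) ⟩
      2 * (κ * a + t * m)     ≡⟨ solve (g ∷ t ∷ k ∷ a ∷ m ∷ []) ⟩
      2 * (κ * a) + 2 * t * m ≤⟨ +-monoʳ-≤ (2 * (κ * a)) (*-monoˡ-≤ m 2t≤L) ⟩
      2 * (κ * a) + L * m     ∎)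

  -- Ψ⁺ − Ψ⁻ is the invariant quadratic form, split into its positive and negative parts.  The
  -- products u = B M, φ = F M and γ = g M are separate arguments so that F M = P A + H and
  -- g M = κ P + g t^L can be substituted in U+X⁻≡V+X⁺.
  Ψ⁺ : (u φ γ p m : ℕ) → ℕ
  Ψ⁺ u φ γ p m = κ * κ * (κ * κ * u) + 2 * t * (κ * κ * κ) * φ + t * (n + t) * g * (m * γ) + 2 * t * t * κ * (p * γ)
  {-# INLINE Ψ⁺ #-}

  Ψ⁻ : (a γ p m : ℕ) → ℕ
  Ψ⁻ a γ p m = κ * κ * (κ * κ * (a * a)) + k * (n + t) * (κ * κ * (a * m)) + 2 * t * (κ * κ * κ) * (p * a)
    + t * (n + t) * g * κ * (p * m) + t * t * (κ * κ) * (p * p) + t * t * (γ * γ)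
  {-# INLINE Ψ⁻ #-}

  Ψ-step : ∀ m p a f b →
    let p′ = g * m + t * p ; m′ = n * m ; a′ = n * a + p′ ; f′ = g * a + t * f + p′
        b′ = n * b + 2 * (g * a + t * f) + p′ in
    Ψ⁺ (b′ * m′) (f′ * m′) (g * m′) p′ m′ + n * n * Ψ⁻ a (g * m) p m
      ≡ Ψ⁻ a′ (g * m′) p′ m′ + n * n * Ψ⁺ (b * m) (f * m) (g * m) p m
  Ψ-step m p a f b = solve (g ∷ t ∷ k ∷ m ∷ p ∷ a ∷ f ∷ b ∷ [])

  Ψ-balanced : ∀ L → Ψ⁺ (B L * M L) (F L * M L) (g * M L) (P L) (M L)
                   ≡ Ψ⁻ (A L) (g * M L) (P L) (M L) + g * g * t * n * (M L * M L)
  Ψ-balanced zero    = solve (g ∷ t ∷ k ∷ [])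
  Ψ-balanced (suc L) =
    trans (excess-scales (n * n) (g * g * t * n * (M L * M L)) (Ψ-step (M L) (P L) (A L) (F L) (B L)) (Ψ-balanced L))
          (cong (Ψ⁻ (A (suc L)) (g * M (suc L)) (P (suc L)) (M (suc L)) +_) (rescale (M L)))
    where
    rescale : ∀ m → n * n * (g * g * t * n * (m * m)) ≡ g * g * t * n * (n * m * (n * m))
    rescale m = solve (g ∷ t ∷ k ∷ m ∷ [])

  -- (Dtrans − Dinf) · D L = U L − V L, and X⁺ L − X⁻ L is the same difference written with
  -- nonnegative terms of order M².
  U V D X⁺ X⁻ : ℕ → ℕ
  U L  = κ * κ * (κ * κ * (B L * M L))
  V L  = κ * κ * (κ * κ * (A L * A L)) + k * (n + t) * (κ * κ * (A L * M L))
  D L  = κ * κ * (κ * κ * (A L * M L))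
  X⁺ L = g * g * t * n * (M L * M L) + t * t * (g * t ^ L * (g * t ^ L))
  X⁻ L = 2 * t * (κ * κ * κ) * H L + t * (n + t) * g * (g * t ^ L * M L)

  U+X⁻≡V+X⁺ : ∀ L → U L + X⁻ L ≡ V L + X⁺ L
  U+X⁻≡V+X⁺ L = substitute (FM≡PA+H L) (sym (κP+gtᴸ≡gM L)) (Ψ-balanced L)
    where
    open ≡-Reasoning
    substitute : ∀ {u φ γ p a m h y} → φ ≡ p * a + h → γ ≡ κ * p + y →
      Ψ⁺ u φ γ p m ≡ Ψ⁻ a γ p m + g * g * t * n * (m * m) →
      κ * κ * (κ * κ * u) + (2 * t * (κ * κ * κ) * h + t * (n + t) * g * (y * m))
        ≡ κ * κ * (κ * κ * (a * a)) + k * (n + t) * (κ * κ * (a * m)) + (g * g * t * n * (m * m) + t * t * (y * y))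
    substitute {u} {p = p} {a} {m} {h} {y} refl refl Ψ⁺≡Ψ⁻+c = +-cancelʳ-≡ common _ _ (begin
      κ * κ * (κ * κ * u) + (2 * t * (κ * κ * κ) * h + t * (n + t) * g * (y * m)) + common
        ≡⟨ solve (g ∷ t ∷ k ∷ u ∷ p ∷ a ∷ m ∷ h ∷ y ∷ []) ⟩
      Ψ⁺ u (p * a + h) (κ * p + y) p m
        ≡⟨ Ψ⁺≡Ψ⁻+c ⟩
      Ψ⁻ a (κ * p + y) p m + g * g * t * n * (m * m)
        ≡⟨ solve (g ∷ t ∷ k ∷ u ∷ p ∷ a ∷ m ∷ h ∷ y ∷ []) ⟩
      κ * κ * (κ * κ * (a * a)) + k * (n + t) * (κ * κ * (a * m)) + (g * g * t * n * (m * m) + t * t * (y * y))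
        + common ∎)
      where
      common : ℕ
      common = 2 * t * (κ * κ * κ) * (p * a) + t * (n + t) * g * κ * (p * m) + 2 * t * t * (κ * κ) * (p * p)
             + 2 * t * t * κ * (p * y)
      {-# INLINE common #-}

  C : ℕ
  C = g * g * t * n + t * t * (g * g) + 2 * t * (κ * κ * κ) * n + t * (n + t) * g * g
  {-# INLINE C #-}

  X⁻+X⁺≤CM² : 1 ≤ κ → ∀ L → X⁻ L + X⁺ L ≤ C * (M L * M L)
  X⁻+X⁺≤CM² 1≤κ L = begin
    X⁻ L + X⁺ L
      ≤⟨ +-mono-≤ (+-mono-≤ (*-monoʳ-≤ (2 * t * (κ * κ * κ)) (H≤nM² 1≤κ L))
                            (*-monoʳ-≤ (t * (n + t) * g) (*-monoˡ-≤ (M L) (gtᴸ≤gM L))))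
                  (+-monoʳ-≤ (g * g * t * n * (M L * M L)) (*-monoʳ-≤ (t * t) (*-mono-≤ (gtᴸ≤gM L) (gtᴸ≤gM L)))) ⟩
    2 * t * (κ * κ * κ) * (n * (M L * M L)) + t * (n + t) * g * (g * M L * M L)
      + (g * g * t * n * (M L * M L) + t * t * (g * M L * (g * M L)))
      ≡⟨ regroup (M L) ⟩
    C * (M L * M L) ∎
    where
    open ≤-Reasoning
    regroup : ∀ m → 2 * t * (κ * κ * κ) * (n * (m * m)) + t * (n + t) * g * (g * m * m)
                      + (g * g * t * n * (m * m) + t * t * (g * m * (g * m))) ≡ C * (m * m)
    regroup m = solve (g ∷ t ∷ k ∷ m ∷ [])

  ∣U-V∣≤CM² : 1 ≤ κ → ∀ L → ∣ U L - V L ∣ ≤ C * (M L * M L)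
  ∣U-V∣≤CM² 1≤κ L = ≤-trans (m+x≡n+y⇒∣m-n∣≤x+y {U L} {V L} {X⁻ L} {X⁺ L} (U+X⁻≡V+X⁺ L)) (X⁻+X⁺≤CM² 1≤κ L)

  LM²≤2D : 1 ≤ g → ∀ L → 2 * t ≤ L → L * (M L * M L) ≤ 2 * D L
  LM²≤2D 1≤g L 2t≤L = begin
    L * (M L * M L)                     ≡⟨ *-assoc L (M L) (M L) ⟨
    L * M L * M L                       ≤⟨ *-monoˡ-≤ (M L) (LM≤2κA 1≤g L 2t≤L) ⟩
    2 * (κ * A L) * M L                 ≡⟨ regroup (A L) (M L) ⟩
    2 * (1 * (κ * (A L * M L)))         ≤⟨ *-monoʳ-≤ 2 (*-monoˡ-≤ (κ * (A L * M L)) 1≤κ³) ⟩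
    2 * (κ * κ * κ * (κ * (A L * M L))) ≡⟨ cong (2 *_) (regroup′ (A L) (M L)) ⟩
    2 * D L                             ∎
    where
    open ≤-Reasoning
    1≤κ³ : 1 ≤ κ * κ * κ
    1≤κ³ = let 1≤κ = 1≤g⇒1≤κ 1≤g in *-mono-≤ (*-mono-≤ 1≤κ 1≤κ) 1≤κ
    regroup : ∀ a m → 2 * (κ * a) * m ≡ 2 * (1 * (κ * (a * m)))
    regroup a m = solve (g ∷ k ∷ a ∷ m ∷ [])
    regroup′ : ∀ a m → κ * κ * κ * (κ * (a * m)) ≡ κ * κ * (κ * κ * (a * m))
    regroup′ a m = solve (g ∷ k ∷ a ∷ m ∷ [])

  A-nonZero : 1 ≤ g → ∀ L .{{_ : NonZero L}} → 2 * t ≤ L → NonZero (A L)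
  A-nonZero 1≤g L 2t≤L = ≢-nonZero λ A≡0 → ≢-nonZero⁻¹ (L * M L) {{m*n≢0 L (M L)}}
    (n≤0⇒n≡0 (≤-trans (subst (λ a → L * M L ≤ 2 * (κ * a)) A≡0 (LM≤2κA 1≤g L 2t≤L))
                      (≤-reflexive (cong (2 *_) (*-zeroʳ κ)))))
    where
    instance
      M-nonZero : NonZero (M L)
      M-nonZero = m^n≢0 n L {{>-nonZero (1≤g⇒1≤n 1≤g)}}

module Words (N : ℕ) (typ : Fin N → SymType) where

  import Data.Bool as Bool
  open import Data.Nat
  open import Data.Nat.Properties
  open import Data.Nat.Tactic.RingSolver using (solve-∀)
  open import Data.Rational using (ℚ)
  import Data.Rational as ℚ
  import Data.Rational.Properties as ℚₚ
  open import Data.Vec using (Vec; []; _∷_; _∷ʳ_)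
  open Naturals
  open Rationals
  open Observables

  g t k : ℕ
  g = count N typ GEN
  t = count N typ PROP
  k = count N typ KILL

  open Moments g t k public

  countIn : SymType → List (Fin N) → ℕ
  countIn τ xs = length (filter (λ x → isType τ (typ x) Bool.≟ true) xs)

  ∑-by-type : ∀ xs (h : Bool → ℕ) s → ∑ xs (λ x → h (T (typ x) s))
              ≡ countIn GEN xs * h true + countIn PROP xs * h s + countIn KILL xs * h false
  ∑-by-type []       h s = refl
  ∑-by-type (x ∷ xs) h s with typ x
  ... | GEN  = trans (cong (h true +_) (∑-by-type xs h s))
                     (regroup (countIn GEN xs) (countIn PROP xs) (countIn KILL xs) (h true) (h s) (h false))
    where
    regroup : ∀ a b c x y z → x + (a * x + b * y + c * z) ≡ suc a * x + b * y + c * z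
    regroup = solve-∀
  ... | PROP = trans (cong (h s +_) (∑-by-type xs h s))
                     (regroup (countIn GEN xs) (countIn PROP xs) (countIn KILL xs) (h true) (h s) (h false))
    where
    regroup : ∀ a b c x y z → y + (a * x + b * y + c * z) ≡ a * x + suc b * y + c * z
    regroup = solve-∀
  ... | KILL = trans (cong (h false +_) (∑-by-type xs h s))
                     (regroup (countIn GEN xs) (countIn PROP xs) (countIn KILL xs) (h true) (h s) (h false))
    where
    regroup : ∀ a b c x y z → z + (a * x + b * y + c * z) ≡ a * x + b * y + suc c * z
    regroup = solve-∀

  N≡n : N ≡ n
  N≡n = begin
    N                       ≡⟨ length-tabulate {n = N} (λ i → i) ⟨
    length (allFin N)       ≡⟨ ∑-const-1 (allFin N) ⟨
    ∑ (allFin N) (λ _ → 1)  ≡⟨ ∑-by-type (allFin N) (λ _ → 1) false ⟩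
    g * 1 + t * 1 + k * 1   ≡⟨ cong₂ _+_ (cong₂ _+_ (*-identityʳ g) (*-identityʳ t)) (*-identityʳ k) ⟩
    g + t + k               ∎
    where open ≡-Reasoning

  stateFrom : ∀ {L} → Bool → Vec (Fin N) L → Bool
  stateFrom s []      = s
  stateFrom s (x ∷ w) = stateFrom (T (typ x) s) w

  stateFrom-∷ʳ : ∀ {L} s (w : Vec (Fin N) L) x → stateFrom s (w ∷ʳ x) ≡ T (typ x) (stateFrom s w)
  stateFrom-∷ʳ s []      x = refl
  stateFrom-∷ʳ s (y ∷ w) x = stateFrom-∷ʳ (T (typ y) s) w x

  νFrom-∷ʳ : ∀ {L} s (w : Vec (Fin N) L) x →
    νFrom typ s (w ∷ʳ x) ≡ νFrom typ s w + bit (T (typ x) (stateFrom s w))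
  νFrom-∷ʳ s []      x = +-identityʳ _
  νFrom-∷ʳ s (y ∷ w) x = trans (cong (bit (T (typ y) s) +_) (νFrom-∷ʳ (T (typ y) s) w x))
                               (sym (+-assoc (bit (T (typ y) s)) _ _))

  ∑-words-∷ : ∀ L f → ∑ (words N (suc L)) f ≡ ∑ (allFin N) (λ x → ∑ (words N L) (λ w → f (x ∷ w)))
  ∑-words-∷ L f = trans (∑-concatMap (λ x → map (x ∷_) (words N L)) (allFin N) f)
                        (∑-cong (allFin N) (λ x → ∑-map (x ∷_) (words N L) f))

  ∑-words-∷ʳ : ∀ L f → ∑ (words N (suc L)) f ≡ ∑ (words N L) (λ w → ∑ (allFin N) (λ x → f (w ∷ʳ x)))
  ∑-words-∷ʳ zero    f = trans (∑-words-∷ zero f)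
    (trans (∑-cong (allFin N) (λ x → +-identityʳ (f (x ∷ [])))) (sym (+-identityʳ _)))
  ∑-words-∷ʳ (suc L) f = trans (∑-words-∷ (suc L) f)
    (trans (∑-cong (allFin N) (λ x → ∑-words-∷ʳ L (λ w → f (x ∷ w)))) (sym (∑-words-∷ L _)))

  ∑-words-⟦⟧ : ∀ q L → ∑ (words N L) (λ w → ⟦ q ⟧ (ν typ w) (bit (stateFrom false w))) ≡ q · L
  ∑-words-⟦⟧ q zero    = trans (+-identityʳ _) (⟦⟧-at-0 q)
  ∑-words-⟦⟧ q (suc L) = begin
    ∑ (words N (suc L)) (λ w → ⟦ q ⟧ (ν typ w) (bit (stateFrom false w)))
      ≡⟨ ∑-words-∷ʳ L _ ⟩
    ∑ (words N L) (λ w → ∑ (allFin N) (λ x → ⟦ q ⟧ (ν typ (w ∷ʳ x)) (bit (stateFrom false (w ∷ʳ x)))))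
      ≡⟨ ∑-cong (words N L) extend ⟩
    ∑ (words N L) (λ w → ⟦ step q ⟧ (ν typ w) (bit (stateFrom false w)))
      ≡⟨ ∑-words-⟦⟧ (step q) L ⟩
    step q · L
      ≡⟨ step-· q L ⟩
    q · suc L ∎
    where
    open ≡-Reasoning
    extend : ∀ w → ∑ (allFin N) (λ x → ⟦ q ⟧ (ν typ (w ∷ʳ x)) (bit (stateFrom false (w ∷ʳ x))))
                   ≡ ⟦ step q ⟧ (ν typ w) (bit (stateFrom false w))
    extend w = begin
      ∑ (allFin N) (λ x → ⟦ q ⟧ (ν typ (w ∷ʳ x)) (bit (stateFrom false (w ∷ʳ x))))
        ≡⟨ ∑-cong (allFin N) (λ x → cong₂ (λ v s → ⟦ q ⟧ v (bit s)) (νFrom-∷ʳ false w x) (stateFrom-∷ʳ false w x)) ⟩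
      ∑ (allFin N) (λ x → ⟦ q ⟧ (ν typ w + bit (T (typ x) s)) (bit (T (typ x) s)))
        ≡⟨ ∑-by-type (allFin N) (λ s′ → ⟦ q ⟧ (ν typ w + bit s′) (bit s′)) s ⟩
      g * ⟦ q ⟧ (ν typ w + 1) 1 + t * ⟦ q ⟧ (ν typ w + bit s) (bit s) + k * ⟦ q ⟧ (ν typ w + 0) 0
        ≡⟨ ⟦step⟧ q (ν typ w) s ⟩
      ⟦ step q ⟧ (ν typ w) (bit s) ∎
      where s = stateFrom false w

  E-ℕ→ℚ : ∀ L {φ} f → (∀ w → φ w ≡ ℕ→ℚ (f w)) → E N L φ ≡ ℕ→ℚ (∑ (words N L) f) /' ℕ→ℚ (M L)
  E-ℕ→ℚ L f φ≗f = cong₂ _/'_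
    (trans (cong (foldr ℚ._+_ ℚ.0ℚ) (trans (map-cong φ≗f (words N L)) (map-∘ (words N L))))
           (ℕ→ℚ-sum (map f (words N L))))
    (cong (λ m → ℕ→ℚ (m ^ L)) N≡n)

  Eν≡A/M : ∀ L → Eν N typ L ≡ ℕ→ℚ (A L) /' ℕ→ℚ (M L)
  Eν≡A/M L = trans (E-ℕ→ℚ L (ν typ) (λ _ → refl)) (cong (λ a → ℕ→ℚ a /' ℕ→ℚ (M L)) (begin
    ∑ (words N L) (ν typ)
      ≡⟨ ∑-cong (words N L) (λ w → sym (ν-observable (ν typ w) (bit (stateFrom false w)))) ⟩
    ∑ (words N L) (λ w → ⟦ quadratic 0 0 1 0 0 ⟧ (ν typ w) (bit (stateFrom false w)))
      ≡⟨ ∑-words-⟦⟧ (quadratic 0 0 1 0 0) L ⟩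
    quadratic 0 0 1 0 0 · L
      ≡⟨ ν-moment L ⟩
    A L ∎))
    where open ≡-Reasoning

  Eν²≡B/M : ∀ L → E N L (λ w → ℕ→ℚ (ν typ w) ℚ.* ℕ→ℚ (ν typ w)) ≡ ℕ→ℚ (B L) /' ℕ→ℚ (M L)
  Eν²≡B/M L = trans (E-ℕ→ℚ L (λ w → ν typ w * ν typ w) (λ w → sym (ℕ→ℚ-homo-* (ν typ w) (ν typ w))))
                    (cong (λ b → ℕ→ℚ b /' ℕ→ℚ (M L)) (begin
    ∑ (words N L) (λ w → ν typ w * ν typ w)
      ≡⟨ ∑-cong (words N L) (λ w → sym (ν²-observable (ν typ w) (bit (stateFrom false w)))) ⟩
    ∑ (words N L) (λ w → ⟦ quadratic 0 0 0 0 1 ⟧ (ν typ w) (bit (stateFrom false w)))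
      ≡⟨ ∑-words-⟦⟧ (quadratic 0 0 0 0 1) L ⟩
    quadratic 0 0 0 0 1 · L
      ≡⟨ ν²-moment L ⟩
    B L ∎))
    where open ≡-Reasoning

  module _ (1≤g : 1 ≤ g) where

    instance
      n-nonZero : NonZero n
      n-nonZero = >-nonZero (1≤g⇒1≤n 1≤g)
      κ-nonZero : NonZero κ
      κ-nonZero = >-nonZero (1≤g⇒1≤κ 1≤g)
      N-nonZero : NonZero N
      N-nonZero = subst NonZero (sym N≡n) n-nonZero

    M-nonZero : ∀ L → NonZero (M L)
    M-nonZero L = m^n≢0 n L

    Dtrans·AM : ∀ L .{{_ : NonZero (A L)}} →
      Dtrans N typ L ℚ.* ℕ→ℚ (A L * M L) ≡ ℕ→ℚ (B L * M L) ℚ.- ℕ→ℚ (A L * A L)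
    Dtrans·AM L = begin
      Dtrans N typ L ℚ.* ℕ→ℚ (A L * M L)
        ≡⟨ cong₂ ℚ._*_ (cong₂ (λ e₂ e → (e₂ ℚ.- e ℚ.* e) /' e) (Eν²≡B/M L) (Eν≡A/M L)) (ℕ→ℚ-homo-* (A L) (M L)) ⟩
      ((b /' m ℚ.- (a /' m) ℚ.* (a /' m)) /' (a /' m)) ℚ.* (a ℚ.* m)
        ≡⟨ dispersion-ratio a b m (ℕ→ℚ-≢0 (A L)) (ℕ→ℚ-≢0 (M L) {{M-nonZero L}}) ⟩
      b ℚ.* m ℚ.- a ℚ.* a
        ≡⟨ cong₂ ℚ._-_ (ℕ→ℚ-homo-* (B L) (M L)) (ℕ→ℚ-homo-* (A L) (A L)) ⟨
      ℕ→ℚ (B L * M L) ℚ.- ℕ→ℚ (A L * A L) ∎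
      where
      open ≡-Reasoning
      a b m : ℚ
      a = ℕ→ℚ (A L)
      b = ℕ→ℚ (B L)
      m = ℕ→ℚ (M L)

    Dinf·κ² : Dinf N typ ℚ.* ℕ→ℚ (κ * κ) ≡ ℕ→ℚ (k * (n + t))
    Dinf·κ² = trans (limit-ratio t k κ N N≡κ+t) (cong (λ m → ℕ→ℚ (k * (m + t))) N≡n)
      where
      N≡κ+t : N ≡ κ + t
      N≡κ+t = trans N≡n (trans (+-assoc g t k) (trans (cong (g +_) (+-comm t k)) (sym (+-assoc g k t))))

    [Dtrans-Dinf]·D≡U-V : ∀ L .{{_ : NonZero (A L)}} →
      (Dtrans N typ L ℚ.- Dinf N typ) ℚ.* ℕ→ℚ (D L) ≡ ℕ→ℚ (U L) ℚ.- ℕ→ℚ (V L)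
    [Dtrans-Dinf]·D≡U-V L = begin
      (Dtrans N typ L ℚ.- Dinf N typ) ℚ.* ℕ→ℚ (D L)
        ≡⟨ cong ((Dtrans N typ L ℚ.- Dinf N typ) ℚ.*_) (κ²κ²-cast (A L * M L)) ⟩
      (Dtrans N typ L ℚ.- Dinf N typ) ℚ.* (x ℚ.* (x ℚ.* ℕ→ℚ (A L * M L)))
        ≡⟨ difference-identity {Dtrans N typ L} {Dinf N typ} {x} {ℕ→ℚ (k * (n + t))}
             {ℕ→ℚ (A L * M L)} {ℕ→ℚ (B L * M L)} {ℕ→ℚ (A L * A L)} (Dtrans·AM L) Dinf·κ² ⟩
      x ℚ.* (x ℚ.* ℕ→ℚ (B L * M L)) ℚ.- (x ℚ.* (x ℚ.* ℕ→ℚ (A L * A L)) ℚ.+ ℕ→ℚ (k * (n + t)) ℚ.* (x ℚ.* ℕ→ℚ (A L * M L)))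
        ≡⟨ cong₂ ℚ._-_ (κ²κ²-cast (B L * M L)) V-cast ⟨
      ℕ→ℚ (U L) ℚ.- ℕ→ℚ (V L) ∎
      where
      open ≡-Reasoning
      x : ℚ
      x = ℕ→ℚ (κ * κ)
      κ²κ²-cast : ∀ u → ℕ→ℚ (κ * κ * (κ * κ * u)) ≡ x ℚ.* (x ℚ.* ℕ→ℚ u)
      κ²κ²-cast u = trans (ℕ→ℚ-homo-* (κ * κ) (κ * κ * u)) (cong (x ℚ.*_) (ℕ→ℚ-homo-* (κ * κ) u))
      V-cast : ℕ→ℚ (V L) ≡ x ℚ.* (x ℚ.* ℕ→ℚ (A L * A L)) ℚ.+ ℕ→ℚ (k * (n + t)) ℚ.* (x ℚ.* ℕ→ℚ (A L * M L))
      V-cast = trans (ℕ→ℚ-homo-+ (κ * κ * (κ * κ * (A L * A L))) (k * (n + t) * (κ * κ * (A L * M L))))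
        (cong₂ ℚ._+_ (κ²κ²-cast (A L * A L))
                     (trans (ℕ→ℚ-homo-* (k * (n + t)) (κ * κ * (A L * M L)))
                            (cong (ℕ→ℚ (k * (n + t)) ℚ.*_) (ℕ→ℚ-homo-* (κ * κ) (A L * M L)))))

    ∣Dtrans-Dinf∣≤ : ∀ L → suc (2 * t) ≤ L →
      ℚ.∣ Dtrans N typ L ℚ.- Dinf N typ ∣ ℚ.≤ ℕ→ℚ (2 * C) ℚ.* (ℕ→ℚ 1 /' ℕ→ℚ L)
    ∣Dtrans-Dinf∣≤ L 2t<L =
      inverse-linear-bound {d = D L} {C} {M L * M L} {L} (ℚₚ.0≤∣p∣ r) |r|·D≤CM² (LM²≤2D 1≤g L 2t≤L)
      where
      open ℚₚ.≤-Reasoning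
      2t≤L : 2 * t ≤ L
      2t≤L = <⇒≤ 2t<L
      instance
        L-nonZero : NonZero L
        L-nonZero = >-nonZero (≤-trans (s≤s z≤n) 2t<L)
        M²-nonZero : NonZero (M L * M L)
        M²-nonZero = m*n≢0 (M L) (M L) {{M-nonZero L}} {{M-nonZero L}}
        A-nonZero′ : NonZero (A L)
        A-nonZero′ = A-nonZero 1≤g L 2t≤L
      r : ℚ
      r = Dtrans N typ L ℚ.- Dinf N typ
      |r|·D≤CM² : ℚ.∣ r ∣ ℚ.* ℕ→ℚ (D L) ℚ.≤ ℕ→ℚ (C * (M L * M L))
      |r|·D≤CM² = begin
        ℚ.∣ r ∣ ℚ.* ℕ→ℚ (D L)           ≡⟨ cong (ℚ.∣ r ∣ ℚ.*_) (ℚₚ.0≤p⇒∣p∣≡p (ℕ→ℚ-nonNeg (D L))) ⟨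
        ℚ.∣ r ∣ ℚ.* ℚ.∣ ℕ→ℚ (D L) ∣     ≡⟨ ℚₚ.∣p*q∣≡∣p∣*∣q∣ r (ℕ→ℚ (D L)) ⟨
        ℚ.∣ r ℚ.* ℕ→ℚ (D L) ∣           ≡⟨ cong ℚ.∣_∣ ([Dtrans-Dinf]·D≡U-V L) ⟩
        ℚ.∣ ℕ→ℚ (U L) ℚ.- ℕ→ℚ (V L) ∣   ≡⟨ ℕ→ℚ-∣-∣ (U L) (V L) ⟩
        ℕ→ℚ ∣ U L - V L ∣               ≤⟨ ℕ→ℚ-mono-≤ (∣U-V∣≤CM² (1≤g⇒1≤κ 1≤g) L) ⟩
        ℕ→ℚ (C * (M L * M L))           ∎

import Data.Nat as ℕ
open import Data.Nat using (ℕ; _≤_)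
open import Data.Product using (∃; ∃-syntax; _×_; _,_)
open import Data.Rational using (ℚ; ∣_∣; _-_; _*_) renaming (_≤_ to _≤ℚ_)

theorem6p7 : (N : ℕ) → (typ : Fin N → SymType) → 1 ≤ count N typ GEN →
    ∃[ C ] ∃[ L₀ ] ((L : ℕ) → L₀ ≤ L →
      ∣ Dtrans N typ L - Dinf N typ ∣ ≤ℚ C * (ℕ→ℚ 1 /' ℕ→ℚ L))
theorem6p7 N typ 1≤g = ℕ→ℚ (2 ℕ.* C) , suc (2 ℕ.* t) , ∣Dtrans-Dinf∣≤ 1≤g
  where open Words N typ
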